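{- For every integer $t\ge 5$ there exists $N$ such that for all integers $n\ge N$ and $k\ge 1$ with $n-2k+2=t$, the Kneser graph $\mathrm{KG}(n,k)$ contains an odd topological $K_t$ subgraph.
   Context: For $n>2k$, the Kneser graph $\mathrm{KG}(n,k)$ has as vertices all $k$-element subsets of $\{1,\dots,n\}$, two being adjacent iff they are disjoint. A topological $K_r$ subgraph of a graph $G$ consists of $r$ distinct branching vertices together with $\binom r2$ paths in $G$, one connecting each pair of branching vertices, such that these paths are internally vertex-disjoint from each other and contain no branching vertices other than their endpoints. It is odd if each of these $\binom r2$ paths has an odd number of edges. -}

module Defs where

open import Level using (Level; _⊔_)
open import Data.Nat using (ℕ; suc; _+_; _*_)
open import Data.Fin using (Fin; _<_)
open import Data.Fin.Subset using (Subset; ∣_∣; _∩_; Empty)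
open import Data.List using (List; []; _∷_; _++_; [_]; length)
open import Data.List.Membership.Propositional using (_∈_)
open import Data.List.Relation.Unary.Linked using (Linked)
open import Data.List.Relation.Unary.Unique.Propositional using (Unique)
open import Data.Product using (Σ; ∃; _×_)
open import Data.Sum using (_⊎_)
open import Relation.Binary.PropositionalEquality using (_≡_; _≢_)
open import Relation.Nullary using (¬_)
open import Function.Definitions using (Injective)

record Graph : Set₁ where
  field
    V   : Set
    Adj : V → V → Set

KG : ℕ → ℕ → Graph
KG n k = record
  { V   = Σ (Subset n) (λ s → ∣ s ∣ ≡ k)
  ; Adj = λ A B → Empty (Σ.proj₁ A ∩ Σ.proj₁ B)
  }

IsOdd : ℕ → Set
IsOdd m = ∃ λ j → m ≡ suc (2 * j)

-- For each pair i < j the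
-- connecting path is  branch i ∷ inner i j ++ [ branch j ]  (the values of
-- inner i j for i ≥ j are irrelevant).
record TopK (G : Graph) (r : ℕ) : Set where
  open Graph G
  field
    branch     : Fin r → V
    branch-inj : Injective _≡_ _≡_ branch
    inner      : Fin r → Fin r → List V
  fullPath : Fin r → Fin r → List V
  fullPath i j = branch i ∷ (inner i j ++ [ branch j ])
  field
    isWalk      : ∀ i j → i < j → Linked Adj (fullPath i j)
    innerUnique : ∀ i j → i < j → Unique (inner i j)
    innerNotBranch : ∀ i j → i < j → ∀ v → v ∈ inner i j → ∀ m → v ≢ branch m
    innerDisjoint : ∀ i j i′ j′ → i < j → i′ < j′ → (i ≢ i′ ⊎ j ≢ j′) →
                    ∀ v → v ∈ inner i j → ¬ (v ∈ inner i′ j′)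

module _ {G : Graph} {r : ℕ} (T : TopK G r) where
  open TopK T
  edges : Fin r → Fin r → ℕ
  edges i j = suc (length (inner i j))

record OddTopK (G : Graph) (r : ℕ) : Set where
  field
    top : TopK G r
    odd : ∀ i j → i < j → IsOdd (edges top i j)

module Submission where

-- For t = 5 + r, s = t - 2 and q ≥ t put k = q + s, so n = 2k + t - 2 splits
-- as (2q+1) + 2s + (s-1) into blocks Z, M, W; vertices of KG(n,k) are given
-- blockwise by boolean predicates.  Branch vertex e is B e ∪ W with
-- B e = [q-e, 2q-e] ⊆ Z.  The q-subsets E a = Z ∖ B a and O a = [q-a, 2q-a)
-- form an odd cycle E 0, O 0, E 1, …, O (q-1), E q, E 0 in KG(2q+1, q).
-- The path joining branch vertices t-u and t-v (u < v) follows this cycle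
-- from E (t-u) to E (t-v) inside Z, carries in M alternately the s-set
-- tag u v (an anchor, marks at u and v, t - 5 fillers) and its complement,
-- and is empty on W.  It has an odd number of edges; the marks separate the
-- paths of different pairs, and W separates them from the branch vertices.

open import Defs
open import Data.Nat using (ℕ; _+_; _*_; _≤_)
open import Data.Product using (∃)
open import Relation.Binary.PropositionalEquality using (_≡_)

open import Function using (_∘_)
open import Data.Nat using (zero; suc; _∸_; _<_; z≤n; s≤s; _<?_)
open import Data.Nat.Properties
open import Data.Nat.Tactic.RingSolver using (solve-∀)
open import Data.Bool using (Bool; true; false; not; _∧_; _∨_)
open import Data.Bool.Properties using (∧-comm; ∧-inverseˡ; ∧-inverseʳ; ∧-zeroʳ; ∨-zeroʳ; not-injective; not-¬)
open import Data.Empty using (⊥)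
open import Data.Product using (Σ; _×_; _,_; proj₁)
open import Data.Sum using (_⊎_; inj₁; inj₂)
open import Data.Fin using (Fin; toℕ; fromℕ<)
open import Data.Fin.Properties using (toℕ-injective; toℕ<n; toℕ-fromℕ<)
open import Data.Fin.Subset using (Subset; ∣_∣; _∩_; Empty; _∈_)
open import Data.Fin.Subset.Properties using (x∈p∩q⁻; ∩-comm)
open import Data.Vec using (tabulate; lookup)
open import Data.Vec.Properties using ([]=⇒lookup; lookup∘tabulate)
open import Data.List using (List; []; _∷_; _++_; [_]; length)
open import Data.List.Properties using (++-assoc; length-++)
open import Data.List.Membership.Propositional using () renaming (_∈_ to _∈ₗ_)
open import Data.List.Relation.Unary.Any using (here; there)
open import Data.List.Relation.Unary.All as All using (All; []; _∷_)
open import Data.List.Relation.Unary.All.Properties using () renaming (++⁺ to All-++⁺)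
open import Data.List.Relation.Unary.AllPairs using ([]; _∷_)
open import Data.List.Relation.Unary.Linked using (Linked; [-]; _∷_)
open import Data.List.Relation.Unary.Unique.Propositional using (Unique)
open import Data.List.Relation.Unary.Unique.Propositional.Properties using () renaming (++⁺ to Unique-++⁺)
open import Relation.Binary using (tri<; tri≈; tri>)
open import Relation.Binary.PropositionalEquality using (refl; sym; trans; cong; cong₂; subst; _≢_; module ≡-Reasoning)
open import Relation.Nullary using (¬_; Dec; yes; no; contradiction)

never always : ℕ → Bool
never _  = false
always _ = true

indicator : Bool → ℕ
indicator true  = 1
indicator false = 0

count : (ℕ → Bool) → ℕ → ℕ
count P zero    = 0
count P (suc m) = indicator (P 0) + count (P ∘ suc) m

Disjoint : (ℕ → Bool) → (ℕ → Bool) → ℕ → Set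
Disjoint P Q m = ∀ x → x < m → (P x ∧ Q x) ≡ false

count-never : ∀ m → count never m ≡ 0
count-never zero    = refl
count-never (suc m) = count-never m

count-always : ∀ m → count always m ≡ m
count-always zero    = refl
count-always (suc m) = cong suc (count-always m)

disjoint-sym : ∀ {P Q m} → Disjoint P Q m → Disjoint Q P m
disjoint-sym {P} {Q} d x x<m = trans (∧-comm (Q x) (P x)) (d x x<m)

inside-disjoint : ∀ {P R : ℕ → Bool} {x} → (P x ≡ true → R x ≡ true) → (P x ∧ not (R x)) ≡ false
inside-disjoint {P} {R} {x} P⊆R with P x
... | false = refl
... | true  = cong not (P⊆R refl)

count-not : ∀ P m → count (not ∘ P) m + count P m ≡ m
count-not P zero = refl
count-not P (suc m) with P 0 | count-not (P ∘ suc) m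
... | true  | ih = trans (+-suc _ _) (cong suc ih)
... | false | ih = cong suc ih

count-∨ : ∀ P Q m → Disjoint P Q m →
          count (λ x → P x ∨ Q x) m ≡ count P m + count Q m
count-∨ P Q zero    _ = refl
count-∨ P Q (suc m) disj
  with P 0 in P0 | Q 0 in Q0 | count-∨ (P ∘ suc) (Q ∘ suc) m (λ x x<m → disj (suc x) (s≤s x<m))
... | true  | true  | _  = contradiction (trans (sym (cong₂ _∧_ P0 Q0)) (disj 0 (s≤s z≤n))) λ ()
... | true  | false | ih = cong suc ih
... | false | true  | ih = trans (cong suc ih) (sym (+-suc _ _))
... | false | false | ih = ih

glue : ℕ → (ℕ → Bool) → (ℕ → Bool) → ℕ → Bool
glue zero    P Q x       = Q x
glue (suc m) P Q zero    = P zero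
glue (suc m) P Q (suc x) = glue m (P ∘ suc) Q x

count-glue : ∀ m P Q l → count (glue m P Q) (m + l) ≡ count P m + count Q l
count-glue zero    P Q l = refl
count-glue (suc m) P Q l =
  trans (cong (indicator (P 0) +_) (count-glue m (P ∘ suc) Q l)) (sym (+-assoc (indicator (P 0)) _ _))

glue-below : ∀ {m P Q x} → x < m → glue m P Q x ≡ P x
glue-below {suc m} {x = zero}  _         = refl
glue-below {suc m} {x = suc x} (s≤s x<m) = glue-below {m} x<m

glue-above : ∀ m P Q y → glue m P Q (m + y) ≡ Q y
glue-above zero    P Q y = refl
glue-above (suc m) P Q y = glue-above m (P ∘ suc) Q y

glue-disjoint : ∀ {m l P P′ Q Q′} → Disjoint P P′ m → Disjoint Q Q′ l →
                Disjoint (glue m P Q) (glue m P′ Q′) (m + l)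
glue-disjoint {zero}  _  dQ x       x<l       = dQ x x<l
glue-disjoint {suc m} dP dQ zero    _         = dP 0 (s≤s z≤n)
glue-disjoint {suc m} dP dQ (suc x) (s≤s x<) =
  glue-disjoint {m} (λ y y<m → dP (suc y) (s≤s y<m)) dQ x x<

initial : ℕ → ℕ → Bool
initial d = glue d always never

interval : ℕ → ℕ → ℕ → Bool
interval lo d = glue lo never (initial d)

count-interval : ∀ lo d m → lo + d ≤ m → count (interval lo d) m ≡ d
count-interval lo d m lo+d≤m = begin
  count (interval lo d) m
    ≡⟨ cong (count (interval lo d)) (sym split) ⟩
  count (interval lo d) (lo + (d + rest))
    ≡⟨ count-glue lo never _ (d + rest) ⟩
  count never lo + count (initial d) (d + rest)
    ≡⟨ cong₂ _+_ (count-never lo) (count-glue d always never rest) ⟩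
  count always d + count never rest
    ≡⟨ cong₂ _+_ (count-always d) (count-never rest) ⟩
  d + 0
    ≡⟨ +-identityʳ d ⟩
  d ∎
  where
  open ≡-Reasoning
  rest = m ∸ (lo + d)
  split : lo + (d + rest) ≡ m
  split = trans (sym (+-assoc lo d rest)) (m+[n∸m]≡n lo+d≤m)

interval-in : ∀ lo d x → lo ≤ x → x < lo + d → interval lo d x ≡ true
interval-in zero     d x       _       x<d       = glue-below x<d
interval-in (suc lo) d (suc x) (s≤s p) (s≤s x<) = interval-in lo d x p x<

interval-bounds : ∀ lo d x → interval lo d x ≡ true → lo ≤ x × x < lo + d
interval-bounds zero     d x       e = z≤n , initial-bound d x e
  where
  initial-bound : ∀ d x → initial d x ≡ true → x < d
  initial-bound (suc d) zero    _ = s≤s z≤n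
  initial-bound (suc d) (suc x) e = s≤s (initial-bound d x e)
interval-bounds (suc lo) d (suc x) e with interval-bounds lo d x e
... | lo≤x , x< = s≤s lo≤x , s≤s x<

interval-below : ∀ lo d {x} → x < lo → interval lo d x ≡ false
interval-below lo d x<lo = glue-below x<lo

interval-start : ∀ lo {d} → 0 < d → interval lo d lo ≡ true
interval-start lo 0<d = interval-in lo _ lo ≤-refl (m<m+n lo 0<d)

interval-start-unique : ∀ {lo lo′ d d′ m} → 0 < d → 0 < d′ → lo < m → lo′ < m →
  (∀ x → x < m → interval lo d x ≡ interval lo′ d′ x) → lo ≡ lo′
interval-start-unique {lo} {lo′} {d} {d′} 0<d 0<d′ lo<m lo′<m agree with <-cmp lo lo′
... | tri≈ _ eq _ = eq
... | tri< lo<lo′ _ _ = contradiction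
  (trans (sym (interval-start lo 0<d)) (trans (agree lo lo<m) (interval-below lo′ d′ lo<lo′))) λ ()
... | tri> _ _ lo′<lo = contradiction
  (trans (sym (interval-start lo′ 0<d′)) (trans (sym (agree lo′ lo′<m)) (interval-below lo d lo′<lo))) λ ()

orient : Bool → (ℕ → Bool) → ℕ → Bool
orient true  P   = P
orient false P x = not (P x)

orient-cong : ∀ b {P Q x y} → P x ≡ Q y → orient b P x ≡ orient b Q y
orient-cong true  e = e
orient-cong false e = cong not e

orient-injective : ∀ b {P Q x} → orient b P x ≡ orient b Q x → P x ≡ Q x
orient-injective true  e = e
orient-injective false e = not-injective e

orient-disjoint : ∀ {b b′} P x → b ≢ b′ → (orient b P x ∧ orient b′ P x) ≡ false
orient-disjoint {true}  {true}  P x ne = contradiction refl ne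
orient-disjoint {true}  {false} P x ne = ∧-inverseʳ (P x)
orient-disjoint {false} {true}  P x ne = ∧-inverseˡ (P x)
orient-disjoint {false} {false} P x ne = contradiction refl ne

count-orient : ∀ b P m → count P m + count P m ≡ m → count (orient b P) m ≡ count P m
count-orient true  P m _    = refl
count-orient false P m half = +-cancelʳ-≡ (count P m) _ _ (trans (count-not P m) (sym half))

point : ℕ → ℕ → Bool
point u = interval u 1

pair : ℕ → ℕ → ℕ → Bool
pair u v y = point u y ∨ point v y

point-self : ∀ u → point u u ≡ true
point-self u = interval-start u (s≤s z≤n)

point-only : ∀ {u y} → point u y ≡ true → y ≡ u
point-only {u} {y} e with interval-bounds u 1 y e
... | u≤y , y< = ≤-antisym (≤-pred (subst (y <_) (+-comm u 1) y<)) u≤y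

pair-member : ∀ u v y → pair u v y ≡ true → y ≡ u ⊎ y ≡ v
pair-member u v y e with point u y in pu
... | true  = inj₁ (point-only pu)
... | false = inj₂ (point-only e)

pair-left : ∀ u v → pair u v u ≡ true
pair-left u v = cong (_∨ point v u) (point-self u)

pair-right : ∀ u v → pair u v v ≡ true
pair-right u v = trans (cong (point u v ∨_) (point-self v)) (∨-zeroʳ _)

count-pair : ∀ {m u v} → u < v → v < m → count (pair u v) m ≡ 2
count-pair {m} {u} {v} u<v v<m = begin
  count (pair u v) m
    ≡⟨ count-∨ (point u) (point v) m apart ⟩
  count (point u) m + count (point v) m
    ≡⟨ cong₂ _+_ (count-interval u 1 m (subst (_≤ m) (+-comm 1 u) (<-trans u<v v<m)))
                 (count-interval v 1 m (subst (_≤ m) (+-comm 1 v) v<m)) ⟩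
  2 ∎
  where
  open ≡-Reasoning
  apart : Disjoint (point u) (point v) m
  apart y _ with point u y in pu | point v y in pv
  ... | false | _     = refl
  ... | true  | false = refl
  ... | true  | true  = contradiction (trans (sym (point-only pu)) (point-only pv)) (<⇒≢ u<v)

pair-determined : ∀ {m u v u′ v′} → u < v → u′ < v′ → v < m → v′ < m →
  (∀ y → y < m → pair u v y ≡ pair u′ v′ y) → u ≡ u′ × v ≡ v′
pair-determined {u = u} {v} {u′} {v′} u<v u′<v′ v<m v′<m agree
  with pair-member u′ v′ u (trans (sym (agree u (<-trans u<v v<m))) (pair-left u v))
... | inj₁ refl with pair-member u′ v′ v (trans (sym (agree v v<m)) (pair-right u v))
...   | inj₁ refl = contradiction u<v (<-irrefl refl)
...   | inj₂ refl = refl , refl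
pair-determined {u = u} {v} {u′} {v′} u<v u′<v′ v<m v′<m agree
    | inj₂ refl with pair-member u v u′ (trans (agree u′ (<-trans u′<v′ v′<m)) (pair-left u′ v′))
...   | inj₁ refl = contradiction u′<v′ (<-irrefl refl)
...   | inj₂ refl = contradiction u<v (<-asym u′<v′)

toSubset : ∀ m → (ℕ → Bool) → Subset m
toSubset m P = tabulate (P ∘ toℕ)

∣toSubset∣ : ∀ m P → ∣ toSubset m P ∣ ≡ count P m
∣toSubset∣ zero    P = refl
∣toSubset∣ (suc m) P with P 0 | ∣toSubset∣ m (P ∘ suc)
... | true  | ih = cong suc ih
... | false | ih = ih

toSubset-member : ∀ {m} P {i : Fin m} → i ∈ toSubset m P → P (toℕ i) ≡ true
toSubset-member P {i} i∈ = trans (sym (lookup∘tabulate (P ∘ toℕ) i)) ([]=⇒lookup i∈)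

toSubset-agree : ∀ {m P Q} → toSubset m P ≡ toSubset m Q → ∀ x → x < m → P x ≡ Q x
toSubset-agree {m} {P} {Q} eq x x<m =
  trans (sym (read P)) (trans (cong (λ S → lookup S (fromℕ< x<m)) eq) (read Q))
  where
  read : ∀ R → lookup (toSubset m R) (fromℕ< x<m) ≡ R x
  read R = trans (lookup∘tabulate (R ∘ toℕ) (fromℕ< x<m)) (cong R (toℕ-fromℕ< x<m))

toSubset-disjoint : ∀ {m P Q} → Disjoint P Q m → Empty (toSubset m P ∩ toSubset m Q)
toSubset-disjoint {m} {P} {Q} disj (i , i∈) with x∈p∩q⁻ (toSubset m P) _ i∈
... | i∈P , i∈Q = contradiction
  (trans (sym (cong₂ _∧_ (toSubset-member P i∈P) (toSubset-member Q i∈Q))) (disj (toℕ i) (toℕ<n i))) λ ()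

module KneserVertices (n k : ℕ) where
  open Graph (KG n k)

  vertex : (P : ℕ → Bool) → count P n ≡ k → V
  vertex P c = toSubset n P , trans (∣toSubset∣ n P) c

  vertex-agree : ∀ {P Q c c′} → vertex P c ≡ vertex Q c′ → ∀ x → x < n → P x ≡ Q x
  vertex-agree eq = toSubset-agree (cong proj₁ eq)

  vertex-adjacent : ∀ P Q {c c′} → Disjoint P Q n → Adj (vertex P c) (vertex Q c′)
  vertex-adjacent P Q = toSubset-disjoint {n} {P} {Q}

  adjacent-sym : ∀ {A B} → Adj A B → Adj B A
  adjacent-sym {A} {B} = subst Empty (∩-comm (proj₁ A) (proj₁ B))

-- Two segments with an odd number of vertices each, joined, give a path
-- with an odd number of edges.
odd-join : ∀ a b → suc (suc (a + a) + suc (b + b)) ≡ suc (2 * suc (a + b))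
odd-join = solve-∀

module Construction (r q : ℕ) where

  t s k zSize mSize wSize n : ℕ
  t     = 5 + r
  s     = 3 + r
  k     = q + s
  zSize = suc (q + q)
  mSize = suc (t + r)
  wSize = suc (suc r)
  n     = zSize + (mSize + wSize)

  open Graph (KG n k)
  open KneserVertices n k

  layout : (ℕ → Bool) → (ℕ → Bool) → (ℕ → Bool) → ℕ → Bool
  layout Z M W = glue zSize Z (glue mSize M W)

  count-layout : ∀ Z M W →
    count (layout Z M W) n ≡ count Z zSize + (count M mSize + count W wSize)
  count-layout Z M W =
    trans (count-glue zSize Z _ (mSize + wSize)) (cong (count Z zSize +_) (count-glue mSize M W wSize))

  layout-disjoint : ∀ {Z Z′ M M′ W W′} → Disjoint Z Z′ zSize → Disjoint M M′ mSize →
    Disjoint W W′ wSize → Disjoint (layout Z M W) (layout Z′ M′ W′) n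
  layout-disjoint dZ dM dW = glue-disjoint {zSize} dZ (glue-disjoint {mSize} dM dW)

  layout-Z : ∀ Z M W {x} → x < zSize → layout Z M W x ≡ Z x
  layout-Z Z M W = glue-below

  layout-M : ∀ Z M W {y} → y < mSize → layout Z M W (zSize + y) ≡ M y
  layout-M Z M W y<m = trans (glue-above zSize Z _ _) (glue-below y<m)

  layout-W : ∀ Z M W y → layout Z M W (zSize + (mSize + y)) ≡ W y
  layout-W Z M W y = trans (glue-above zSize Z _ _) (glue-above mSize M W y)

  Z<n : ∀ {x} → x < zSize → x < n
  Z<n x<z = <-≤-trans x<z (m≤m+n zSize _)

  M<n : ∀ {y} → y < mSize → zSize + y < n
  M<n y<m = +-monoʳ-< zSize (<-≤-trans y<m (m≤m+n mSize wSize))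

  W<n : zSize + (mSize + 0) < n
  W<n = +-monoʳ-< zSize (+-monoʳ-< mSize (s≤s z≤n))

  -- B a = [q-a, 2q-a] has q + 1 points; E a is its complement and
  -- O a = [q-a, 2q-a) has q points.  For a ≤ q these q-sets form the odd cycle
  -- E 0, O 0, E 1, O 1, …, O (q-1), E q, E 0 of the Kneser graph on Z.
  B E O : ℕ → ℕ → Bool
  B a   = interval (q ∸ a) (suc q)
  E a x = not (B a x)
  O a   = interval (q ∸ a) q

  start<zSize : ∀ a → q ∸ a < zSize
  start<zSize a = s≤s (≤-trans (m∸n≤m q a) (m≤m+n q q))

  count-B : ∀ a → count (B a) zSize ≡ suc q
  count-B a = count-interval (q ∸ a) (suc q) zSize
    (≤-trans (+-monoˡ-≤ (suc q) (m∸n≤m q a)) (≤-reflexive (+-suc q q)))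

  count-E : ∀ a → count (E a) zSize ≡ q
  count-E a = +-cancelʳ-≡ (suc q) _ _ (begin
    count (E a) zSize + suc q         ≡⟨ cong (count (E a) zSize +_) (sym (count-B a)) ⟩
    count (E a) zSize + count (B a) zSize ≡⟨ count-not (B a) zSize ⟩
    zSize                             ≡⟨ sym (+-suc q q) ⟩
    q + suc q                         ∎)
    where open ≡-Reasoning

  count-O : ∀ a → count (O a) zSize ≡ q
  count-O a = count-interval (q ∸ a) q zSize (m≤n⇒m≤1+n (+-monoˡ-≤ q (m∸n≤m q a)))

  B-E : ∀ a → Disjoint (B a) (E a) zSize
  B-E a x _ = ∧-inverseʳ (B a x)

  O-E : ∀ a → Disjoint (O a) (E a) zSize
  O-E a x _ = inside-disjoint {O a} {B a} λ e →
    let lo≤x , x< = interval-bounds (q ∸ a) q x e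
    in  interval-in (q ∸ a) (suc q) x lo≤x (≤-trans x< (+-monoʳ-≤ (q ∸ a) (n≤1+n q)))

  O-E-next : ∀ a → a < q → Disjoint (O a) (E (suc a)) zSize
  O-E-next a a<q x _ = inside-disjoint {O a} {B (suc a)} λ e →
    let lo≤x , x< = interval-bounds (q ∸ a) q x e
    in  interval-in (q ∸ suc a) (suc q) x (≤-trans (∸-monoʳ-≤ q (n≤1+n a)) lo≤x) (subst (x <_) same-end x<)
    where
    same-end : (q ∸ a) + q ≡ (q ∸ suc a) + suc q
    same-end = trans (cong (_+ q) (+-∸-assoc 1 a<q)) (sym (+-suc (q ∸ suc a) q))

  -- The edge E q — E 0 closing the cycle: B q ∪ B 0 covers Z.
  E-wrap : Disjoint (E q) (E 0) zSize
  E-wrap x x<z with ≤-total x q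
  ... | inj₁ x≤q = cong (λ b → not b ∧ E 0 x)
                     (interval-in (q ∸ q) (suc q) x (subst (_≤ x) (sym (n∸n≡0 q)) z≤n)
                                  (subst (λ lo → x < lo + suc q) (sym (n∸n≡0 q)) (s≤s x≤q)))
  ... | inj₂ q≤x =
    trans (cong (λ b → E q x ∧ not b) (interval-in q (suc q) x q≤x (subst (x <_) (sym (+-suc q q)) x<z)))
          (∧-zeroʳ (E q x))

  Agree : (ℕ → Bool) → (ℕ → Bool) → Set
  Agree P Q = ∀ x → x < zSize → P x ≡ Q x

  B-injective : ∀ {c c′} → c ≤ q → c′ ≤ q → Agree (B c) (B c′) → c ≡ c′
  B-injective {c} {c′} c≤q c′≤q agree = ∸-cancelˡ-≡ c≤q c′≤q
    (interval-start-unique (s≤s z≤n) (s≤s z≤n) (start<zSize c) (start<zSize c′) agree)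

  E-injective : ∀ {c c′} → c ≤ q → c′ ≤ q → Agree (E c) (E c′) → c ≡ c′
  E-injective c≤q c′≤q agree = B-injective c≤q c′≤q (λ x x<z → not-injective (agree x x<z))

  O-injective : ∀ {c c′} → 0 < q → c ≤ q → c′ ≤ q → Agree (O c) (O c′) → c ≡ c′
  O-injective {c} {c′} 0<q c≤q c′≤q agree = ∸-cancelˡ-≡ c≤q c′≤q
    (interval-start-unique 0<q 0<q (start<zSize c) (start<zSize c′) agree)

  -- The point q lies in every B c, and in O c′ when c′ < q.
  E≢O : ∀ {c c′} → c′ < q → ¬ Agree (E c) (O c′)
  E≢O {c} {c′} c′<q agree = contradiction (trans (sym q∉E) (trans (agree q (s≤s (m≤m+n q q))) q∈O)) λ ()
    where
    q∉E : E c q ≡ false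
    q∉E = cong not (interval-in (q ∸ c) (suc q) q (m∸n≤m q c) (<-≤-trans (n<1+n q) (m≤n+m (suc q) (q ∸ c))))
    q∈O : O c′ q ≡ true
    q∈O = interval-in (q ∸ c′) q q (m∸n≤m q c′) (subst (q <_) (+-comm q (q ∸ c′)) (m<m+n q (m<n⇒0<n∸m c′<q)))

  -- The M-part `tag u v`: an anchor point, the marks `pair u v` on the next
  -- t points, and r = t - 5 fillers; s points in all.
  tag : ℕ → ℕ → ℕ → Bool
  tag u v = glue 1 always (glue t (pair u v) always)

  count-tag : ∀ {u v} → u < v → v < t → count (tag u v) mSize ≡ s
  count-tag {u} {v} u<v v<t = begin
    count (tag u v) mSize
      ≡⟨ count-glue 1 always (glue t (pair u v) always) (t + r) ⟩
    1 + count (glue t (pair u v) always) (t + r)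
      ≡⟨ cong suc (count-glue t (pair u v) always r) ⟩
    1 + (count (pair u v) t + count always r)
      ≡⟨ cong₂ (λ a b → 1 + (a + b)) (count-pair u<v v<t) (count-always r) ⟩
    s ∎
    where open ≡-Reasoning

  s+s≡mSize : s + s ≡ mSize
  s+s≡mSize = cong (suc ∘ suc ∘ suc) (+-comm r (3 + r))

  branch : ℕ → ℕ → Bool
  branch e = layout (B e) never always

  inner : ℕ → ℕ → Bool → (ℕ → Bool) → ℕ → Bool
  inner u v b Z = layout Z (orient b (tag u v)) never

  -- The size proofs are opaque: only their statements matter later on.
  opaque
    count-branch : ∀ e → count (branch e) n ≡ k
    count-branch e = begin
      count (branch e) n
        ≡⟨ count-layout (B e) never always ⟩
      count (B e) zSize + (count never mSize + count always wSize)
        ≡⟨ cong₂ (λ a b → a + (b + count always wSize)) (count-B e) (count-never mSize) ⟩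
      suc q + count always wSize
        ≡⟨ cong (suc q +_) (count-always wSize) ⟩
      suc q + wSize
        ≡⟨ sym (+-suc q wSize) ⟩
      k ∎
      where open ≡-Reasoning

    count-inner : ∀ {u v} b Z → u < v → v < t → count Z zSize ≡ q → count (inner u v b Z) n ≡ k
    count-inner {u} {v} b Z u<v v<t cZ = begin
      count (inner u v b Z) n
        ≡⟨ count-layout Z _ never ⟩
      count Z zSize + (count (orient b (tag u v)) mSize + count never wSize)
        ≡⟨ cong₂ (λ a c → a + (c + count never wSize)) cZ count-M ⟩
      q + (s + count never wSize)
        ≡⟨ cong (λ c → q + (s + c)) (count-never wSize) ⟩
      q + (s + 0)
        ≡⟨ cong (q +_) (+-identityʳ s) ⟩
      k ∎
      where
      open ≡-Reasoning
      count-M : count (orient b (tag u v)) mSize ≡ s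
      count-M = trans (count-orient b (tag u v) mSize
                         (trans (cong₂ _+_ (count-tag u<v v<t) (count-tag u<v v<t)) s+s≡mSize))
                      (count-tag u<v v<t)

  inner-anchor : ∀ u v b Z → inner u v b Z (zSize + 0) ≡ b
  inner-anchor u v true  Z = layout-M Z _ never (s≤s z≤n)
  inner-anchor u v false Z = layout-M Z _ never (s≤s z≤n)

  inner-mark : ∀ u v b Z {y} → y < t → inner u v b Z (zSize + suc y) ≡ orient b (pair u v) y
  inner-mark u v b Z {y} y<t =
    trans (layout-M Z _ never (s≤s (≤-trans y<t (m≤m+n t r))))
          (orient-cong b (glue-below {t} {pair u v} {always} y<t))

  inner-W : ∀ u v b Z → inner u v b Z (zSize + (mSize + 0)) ≡ false
  inner-W u v b Z = layout-W Z _ never 0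

  branch-W : ∀ e → branch e (zSize + (mSize + 0)) ≡ true
  branch-W e = layout-W (B e) never always 0

  -- The vertices of KG(n,k) used in the construction.  Internal vertices are
  -- kept opaque so that equations between them are read off their data.
  branchV : ℕ → V
  branchV e = vertex (branch e) (count-branch e)

  opaque
    innerV : ∀ u v b Z → count (inner u v b Z) n ≡ k → V
    innerV u v b Z = vertex (inner u v b Z)

  opaque
    unfolding innerV

    inner-agree : ∀ {u v u′ v′ b b′ Z Z′ c c′} → innerV u v b Z c ≡ innerV u′ v′ b′ Z′ c′ →
                  ∀ x → x < n → inner u v b Z x ≡ inner u′ v′ b′ Z′ x
    inner-agree {u} {v} {u′} {v′} {b} {b′} {Z} {Z′} = vertex-agree {inner u v b Z} {inner u′ v′ b′ Z′}

    inner-branch-agree : ∀ {u v b Z c} e → innerV u v b Z c ≡ branchV e →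
                         ∀ x → x < n → inner u v b Z x ≡ branch e x
    inner-branch-agree {u} {v} {b} {Z} e = vertex-agree {inner u v b Z} {branch e}

    -- Adjacency: blockwise disjointness, with opposite orientations on M.
    inner-adjacent : ∀ {u v b b′ Z Z′ c c′} → b ≢ b′ → Disjoint Z Z′ zSize →
                     Adj (innerV u v b Z c) (innerV u v b′ Z′ c′)
    inner-adjacent {u} {v} {b} {b′} {Z} {Z′} {c} {c′} b≢b′ dZ =
      vertex-adjacent (inner u v b Z) (inner u v b′ Z′) {c} {c′}
      (layout-disjoint dZ (λ y _ → orient-disjoint (tag u v) y b≢b′) (λ _ _ → refl))

    branch-inner-adjacent : ∀ {u v b e Z c} → Disjoint (B e) Z zSize → Adj (branchV e) (innerV u v b Z c)
    branch-inner-adjacent {u} {v} {b} {e} {Z} {c} dZ =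
      vertex-adjacent (branch e) (inner u v b Z) {count-branch e} {c}
      (layout-disjoint dZ (λ _ _ → refl) (λ _ _ → refl))

  Labelled : ℕ → ℕ → V → Set
  Labelled u v w = ∃ λ b → ∃ λ Z → Σ (count (inner u v b Z) n ≡ k) λ c → w ≡ innerV u v b Z c

  module _ {u v u′ v′ b b′ Z Z′ c c′} (eq : innerV u v b Z c ≡ innerV u′ v′ b′ Z′ c′) where

    inner-bit : b ≡ b′
    inner-bit = trans (sym (inner-anchor u v b Z))
                      (trans (inner-agree eq (zSize + 0) (M<n (s≤s z≤n))) (inner-anchor u′ v′ b′ Z′))

    inner-Z : Agree Z Z′
    inner-Z x x<z = trans (sym (layout-Z Z _ never x<z))
                          (trans (inner-agree eq x (Z<n x<z)) (layout-Z Z′ _ never x<z))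

    inner-pair : ∀ y → y < t → pair u v y ≡ pair u′ v′ y
    inner-pair y y<t = orient-injective b (trans (sym (inner-mark u v b Z y<t))
      (trans (inner-agree eq (zSize + suc y) (M<n (s≤s (≤-trans y<t (m≤m+n t r)))))
             (trans (inner-mark u′ v′ b′ Z′ y<t) (cong (λ b″ → orient b″ (pair u′ v′) y) (sym inner-bit)))))

  distinct-bits : ∀ {u v u′ v′ b b′ Z Z′ c c′} → b ≢ b′ → innerV u v b Z c ≢ innerV u′ v′ b′ Z′ c′
  distinct-bits b≢b′ eq = b≢b′ (inner-bit eq)

  distinct-Z : ∀ {u v u′ v′ b b′ Z Z′ c c′} → ¬ Agree Z Z′ → innerV u v b Z c ≢ innerV u′ v′ b′ Z′ c′
  distinct-Z Z≢Z′ eq = Z≢Z′ (inner-Z eq)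

  labelled-pair : ∀ {u v u′ v′ w} → u < v → u′ < v′ → v < t → v′ < t →
                  Labelled u v w → Labelled u′ v′ w → u ≡ u′ × v ≡ v′
  labelled-pair u<v u′<v′ v<t v′<t (_ , _ , _ , refl) (_ , _ , _ , eq) =
    pair-determined u<v u′<v′ v<t v′<t (inner-pair eq)

  -- Internal vertices miss the W-block, branch vertices contain it.
  labelled-not-branch : ∀ {u v w} e → Labelled u v w → w ≢ branchV e
  labelled-not-branch {u} {v} e (b , Z , c , refl) eq =
    contradiction (trans (sym (inner-W u v b Z)) (trans (inner-branch-agree e eq _ W<n) (branch-W e))) λ ()

  branch-injective : ∀ {e e′} → e ≤ q → e′ ≤ q → branchV e ≡ branchV e′ → e ≡ e′
  branch-injective {e} {e′} e≤q e′≤q eq = B-injective e≤q e′≤q λ x x<z →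
    trans (sym (layout-Z (B e) never always x<z))
          (trans (vertex-agree {branch e} {branch e′} eq x (Z<n x<z)) (layout-Z (B e′) never always x<z))

  -- From here on q ≥ t, so that the branch indices t - i (i < t) lie in [1, q].
  module WithRoom (t≤q : t ≤ q) where

    0<q : 0 < q
    0<q = ≤-trans (s≤s z≤n) t≤q

    record OddPath (x y : V) (u v : ℕ) : Set where
      field
        interior  : List V
        walk      : Linked Adj (x ∷ interior ++ [ y ])
        distinct  : Unique interior
        oddLength : IsOdd (suc (length interior))
        labelled  : All (Labelled u v) interior

    module Path {u v : ℕ} (u<v : u < v) (v<t : v < t) where

      Ev Ov : Bool → ℕ → V
      Ev b a = innerV u v b (E a) (count-inner b (E a) u<v v<t (count-E a))
      Ov b a = innerV u v b (O a) (count-inner b (O a) u<v v<t (count-O a))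

      ladder : Bool → ℕ → ℕ → List V
      ladder b a zero    = [ Ev b a ]
      ladder b a (suc m) = Ev b a ∷ Ov (not b) a ∷ ladder b (suc a) m

      ladder-member : ∀ b a m {w} → w ∈ₗ ladder b a m →
        (∃ λ c → a ≤ c × c ≤ a + m × w ≡ Ev b c) ⊎ (∃ λ c → a ≤ c × c < a + m × w ≡ Ov (not b) c)
      ladder-member b a zero    (here eq) = inj₁ (a , ≤-refl , ≤-reflexive (sym (+-identityʳ a)) , eq)
      ladder-member b a (suc m) (here eq) = inj₁ (a , ≤-refl , m≤m+n a _ , eq)
      ladder-member b a (suc m) (there (here eq)) = inj₂ (a , ≤-refl , m<m+n a (s≤s z≤n) , eq)
      ladder-member b a (suc m) (there (there w∈)) with ladder-member b (suc a) m w∈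
      ... | inj₁ (c , a<c , c≤ , eq) = inj₁ (c , <⇒≤ a<c , subst (c ≤_) (sym (+-suc a m)) c≤ , eq)
      ... | inj₂ (c , a<c , c< , eq) = inj₂ (c , <⇒≤ a<c , subst (c <_) (sym (+-suc a m)) c< , eq)

      -- A ladder inside [0, q] has no repeated vertex: consecutive vertices
      -- differ in orientation, vertices of the same kind in their Z-part.
      ladder-unique : ∀ b a m → a + m ≤ q → Unique (ladder b a m)
      ladder-unique b a zero    _     = [] ∷ []
      ladder-unique b a (suc m) bound =
        (distinct-bits (not-¬ refl) ∷ All.tabulate E-fresh)
        ∷ All.tabulate O-fresh
        ∷ ladder-unique b (suc a) m bound′
        where
        bound′ : suc a + m ≤ q
        bound′ = subst (_≤ q) (+-suc a m) bound
        a≤q : a ≤ q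
        a≤q = ≤-trans (m≤m+n a (suc m)) bound
        E-fresh : ∀ {w} → w ∈ₗ ladder b (suc a) m → Ev b a ≢ w
        E-fresh w∈ with ladder-member b (suc a) m w∈
        ... | inj₁ (c , a<c , c≤ , refl) = distinct-Z λ agree → <-irrefl (E-injective a≤q (≤-trans c≤ bound′) agree) a<c
        ... | inj₂ (_ , _ , _ , refl)    = distinct-bits (not-¬ refl)
        O-fresh : ∀ {w} → w ∈ₗ ladder b (suc a) m → Ov (not b) a ≢ w
        O-fresh w∈ with ladder-member b (suc a) m w∈
        ... | inj₁ (_ , _ , _ , refl)    = distinct-bits (λ e → not-¬ refl (sym e))
        ... | inj₂ (c , a<c , c< , refl) = distinct-Z λ agree →
                <-irrefl (O-injective 0<q a≤q (<⇒≤ (<-≤-trans c< bound′)) agree) a<c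

      -- Consecutive vertices of a ladder are adjacent, so a ladder can be
      -- entered from any neighbour x of its first vertex.
      ladder-linked : ∀ {x} b a m zs → a + m ≤ q → Adj x (Ev b a) →
                      Linked Adj (Ev b (a + m) ∷ zs) → Linked Adj (x ∷ ladder b a m ++ zs)
      ladder-linked b a zero    zs _     x∼ L = x∼ ∷ subst (λ c → Linked Adj (Ev b c ∷ zs)) (+-identityʳ a) L
      ladder-linked b a (suc m) zs bound x∼ L =
        x∼ ∷ inner-adjacent (not-¬ refl) (disjoint-sym {O a} {E a} (O-E a))
           ∷ ladder-linked b (suc a) m zs (subst (_≤ q) (+-suc a m) bound)
               (inner-adjacent (λ e → not-¬ refl (sym e)) (O-E-next a (<-≤-trans (m<m+n a (s≤s z≤n)) bound)))
               (subst (λ c → Linked Adj (Ev b c ∷ zs)) (+-suc a m) L)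

      length-ladder : ∀ b a m → length (ladder b a m) ≡ suc (m + m)
      length-ladder b a zero    = refl
      length-ladder b a (suc m) = cong (suc ∘ suc) (trans (length-ladder b (suc a) m) (sym (+-suc m m)))

      ladder-labelled : ∀ b a m → All (Labelled u v) (ladder b a m)
      ladder-labelled b a zero    = (b , E a , _ , refl) ∷ []
      ladder-labelled b a (suc m) = (b , E a , _ , refl) ∷ (not b , O a , _ , refl) ∷ ladder-labelled b (suc a) m

      -- The path runs from E i₀ up to E q with orientation true, crosses the
      -- edge E q — E 0, and runs from E 0 up to E j₀ with orientation false.
      i₀ j₀ : ℕ
      i₀ = t ∸ u
      j₀ = t ∸ v

      i₀≤q : i₀ ≤ q
      i₀≤q = ≤-trans (m∸n≤m t u) t≤q

      j₀<q : j₀ < q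
      j₀<q = <-≤-trans (∸-monoʳ-< u<v (<⇒≤ v<t)) i₀≤q

      i₀-to-q : i₀ + (q ∸ i₀) ≡ q
      i₀-to-q = m+[n∸m]≡n i₀≤q

      first second : List V
      first  = ladder true i₀ (q ∸ i₀)
      second = ladder false 0 j₀

      -- The halves share no vertex: equal orientations force an E against an O.
      halves-disjoint : ∀ {w} → w ∈ₗ first → w ∈ₗ second → ⊥
      halves-disjoint w∈₁ w∈₂ with ladder-member true i₀ (q ∸ i₀) w∈₁ | ladder-member false 0 j₀ w∈₂
      ... | inj₁ (_ , _ , _ , refl)  | inj₁ (_ , _ , _ , eq)      = distinct-bits (λ ()) eq
      ... | inj₁ (c , _ , _ , refl)  | inj₂ (c′ , _ , c′<j₀ , eq) = distinct-Z (E≢O {c} {c′} (<-trans c′<j₀ j₀<q)) eq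
      ... | inj₂ (c , _ , c< , refl) | inj₁ (c′ , _ , _ , eq)     =
        distinct-Z (λ agree → E≢O {c′} {c} (subst (c <_) i₀-to-q c<) (λ x x<z → sym (agree x x<z))) eq
      ... | inj₂ (_ , _ , _ , refl)  | inj₂ (_ , _ , _ , eq)      = distinct-bits (λ ()) eq

      enter : Adj (branchV i₀) (Ev true i₀)
      enter = branch-inner-adjacent {e = i₀} (B-E i₀)

      leave : Adj (Ev false j₀) (branchV j₀)
      leave = adjacent-sym {branchV j₀} {Ev false j₀} (branch-inner-adjacent {e = j₀} (B-E j₀))

      path : OddPath (branchV i₀) (branchV j₀) u v
      path = record
        { interior  = first ++ second
        ; walk      = subst (λ L → Linked Adj (branchV i₀ ∷ L)) (sym (++-assoc first second [ branchV j₀ ]))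
                        (ladder-linked true i₀ (q ∸ i₀) _ (≤-reflexive i₀-to-q) enter
                          (subst (λ c → Linked Adj (Ev true c ∷ second ++ [ branchV j₀ ])) (sym i₀-to-q)
                            (ladder-linked false 0 j₀ _ (<⇒≤ j₀<q) (inner-adjacent (λ ()) E-wrap) (leave ∷ [-]))))
        ; distinct  = Unique-++⁺ (ladder-unique true i₀ (q ∸ i₀) (≤-reflexive i₀-to-q))
                                 (ladder-unique false 0 j₀ (<⇒≤ j₀<q))
                                 (λ (w∈₁ , w∈₂) → halves-disjoint w∈₁ w∈₂)
        ; oddLength = suc ((q ∸ i₀) + j₀) ,
            trans (cong suc (trans (length-++ first)
                                   (cong₂ _+_ (length-ladder true i₀ (q ∸ i₀)) (length-ladder false 0 j₀))))
                  (odd-join (q ∸ i₀) j₀)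
        ; labelled  = All-++⁺ (ladder-labelled true i₀ (q ∸ i₀)) (ladder-labelled false 0 j₀)
        }

    position : Fin t → ℕ
    position i = t ∸ toℕ i

    position≤q : ∀ i → position i ≤ q
    position≤q i = ≤-trans (m∸n≤m t (toℕ i)) t≤q

    branchF : Fin t → V
    branchF i = branchV (position i)

    branchF-injective : ∀ {i j} → branchF i ≡ branchF j → i ≡ j
    branchF-injective {i} {j} eq = toℕ-injective
      (∸-cancelˡ-≡ (<⇒≤ (toℕ<n i)) (<⇒≤ (toℕ<n j)) (branch-injective (position≤q i) (position≤q j) eq))

    pathF : ∀ i j → toℕ i < toℕ j → OddPath (branchF i) (branchF j) (toℕ i) (toℕ j)
    pathF i j i<j = Path.path i<j (toℕ<n j)

    interiorD : ∀ i j → Dec (toℕ i < toℕ j) → List V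
    interiorD i j (yes i<j) = OddPath.interior (pathF i j i<j)
    interiorD i j (no _)    = []

    interiorF : Fin t → Fin t → List V
    interiorF i j = interiorD i j (toℕ i <? toℕ j)

    along : ∀ {i j} (P : List V → Set) (i<j : toℕ i < toℕ j) →
            P (OddPath.interior (pathF i j i<j)) → P (interiorF i j)
    along {i} {j} P i<j = subst P (sym (chosen (toℕ i <? toℕ j)))
      where
      chosen : ∀ d → interiorD i j d ≡ OddPath.interior (pathF i j i<j)
      chosen (yes i<j′) = cong (OddPath.interior ∘ pathF i j) (<-irrelevant i<j′ i<j)
      chosen (no i≮j)   = contradiction i<j i≮j

    labelledF : ∀ {i j} → toℕ i < toℕ j → All (Labelled (toℕ i) (toℕ j)) (interiorF i j)
    labelledF {i} {j} i<j = along (All (Labelled (toℕ i) (toℕ j))) i<j (OddPath.labelled (pathF i j i<j))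

    interiors-disjoint : ∀ i j i′ j′ → toℕ i < toℕ j → toℕ i′ < toℕ j′ → (i ≢ i′ ⊎ j ≢ j′) →
                         ∀ w → w ∈ₗ interiorF i j → ¬ (w ∈ₗ interiorF i′ j′)
    interiors-disjoint i j i′ j′ i<j i′<j′ differ w w∈ w∈′
      with labelled-pair i<j i′<j′ (toℕ<n j) (toℕ<n j′)
                         (All.lookup (labelledF i<j) w∈) (All.lookup (labelledF i′<j′) w∈′)
    ... | i≡i′ , j≡j′ with differ
    ...   | inj₁ i≢i′ = i≢i′ (toℕ-injective i≡i′)
    ...   | inj₂ j≢j′ = j≢j′ (toℕ-injective j≡j′)

    oddTopK : OddTopK (KG n k) t
    oddTopK = record
      { top = record
        { branch         = branchF
        ; branch-inj     = branchF-injective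
        ; inner          = interiorF
        ; isWalk         = λ i j i<j →
            along (λ L → Linked Adj (branchF i ∷ L ++ [ branchF j ])) i<j (OddPath.walk (pathF i j i<j))
        ; innerUnique    = λ i j i<j → along Unique i<j (OddPath.distinct (pathF i j i<j))
        ; innerNotBranch = λ i j i<j w w∈ m → labelled-not-branch (position m) (All.lookup (labelledF i<j) w∈)
        ; innerDisjoint  = interiors-disjoint
        }
      ; odd = λ i j i<j → along (λ L → IsOdd (suc (length L))) i<j (OddPath.oddLength (pathF i j i<j))
      }

-- With t = 5 + r and s = 3 + r, every (n, k) with n = 2k + t - 2 and
-- n ≥ s + 2(t + s) is (Construction.n r q, Construction.k r q) for some q ≥ t.
-- n = s + 2k splits into the three blocks of sizes 2q+1, 2s and s-1.
layout-sizes : ∀ r q → (3 + r) + 2 * (q + (3 + r)) ≡ suc (q + q) + (suc ((5 + r) + r) + suc (suc r))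
layout-sizes = solve-∀

threshold : ℕ → ℕ
threshold r = (3 + r) + 2 * ((5 + r) + (3 + r))

parameters : ∀ r n k → threshold r ≤ n → n + 2 ≡ (5 + r) + 2 * k →
  ∃ λ q → 5 + r ≤ q × n ≡ Construction.n r q × k ≡ Construction.k r q
parameters r n k N≤n n+2≡ = k ∸ s , t≤q , n≡ , k≡
  where
  t s : ℕ
  t = 5 + r
  s = 3 + r
  n≡2k+s : n ≡ s + 2 * k
  n≡2k+s = suc-injective (suc-injective (trans (+-comm 2 n) n+2≡))
  t+s≤k : t + s ≤ k
  t+s≤k = *-cancelˡ-≤ 2 (+-cancelˡ-≤ s _ _ (subst (threshold r ≤_) n≡2k+s N≤n))
  k≡ : k ≡ (k ∸ s) + s
  k≡ = sym (m∸n+n≡m (≤-trans (m≤n+m s t) t+s≤k))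
  t≤q : t ≤ k ∸ s
  t≤q = +-cancelʳ-≤ s t (k ∸ s) (subst (t + s ≤_) k≡ t+s≤k)
  n≡ : n ≡ Construction.n r (k ∸ s)
  n≡ = trans n≡2k+s (trans (cong (λ k′ → s + 2 * k′) k≡) (layout-sizes r (k ∸ s)))

theorem4 : ∀ (t : ℕ) → 5 ≤ t →
    ∃ λ (N : ℕ) → ∀ (n k : ℕ) → N ≤ n → 1 ≤ k → n + 2 ≡ t + 2 * k →
      OddTopK (KG n k) t
theorem4 _ (s≤s (s≤s (s≤s (s≤s (s≤s (z≤n {r})))))) =
  threshold r , λ n k N≤n _ n+2≡ → realise (parameters r n k N≤n n+2≡)
  where
  realise : ∀ {n k} → (∃ λ q → 5 + r ≤ q × n ≡ Construction.n r q × k ≡ Construction.k r q) →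
            OddTopK (KG n k) (5 + r)
  realise (q , t≤q , refl , refl) = Construction.WithRoom.oddTopK r q t≤q
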